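{- Let $S'$ be a $3$-minor of a proper set system $S=(E,\mathcal F)$. Then there are pairwise disjoint subsets $X,Y,Z$ of $E$ such that $S'$ is obtained from $S$ by deleting the elements of $X$ one at a time, then contracting the elements of $Y$ one at a time, then Penrose contracting the elements of $Z$ one at a time, and such that there is a set $F$ with $F\subseteq E-(X\cup Y\cup Z)$ for which the number of sets $F'\in\mathcal F$ with $F\cup Y\subseteq F'\subseteq F\cup Y\cup Z$ is odd.
   Context: A set system is a pair $S=(E,\mathcal F)$ where $E$ is a finite set and $\mathcal F$ is a collection of subsets of $E$ (the feasible sets); $S$ is proper if $\mathcal F\neq\emptyset$. For $e\in E$: $e$ is a loop if it lies in no feasible set, and a coloop if it lies in every feasible set. If $e$ is not a loop, $S/e=(E-e,\{F-e: e\in F\in\mathcal F\})$; if $e$ is not a coloop, $S\setminus e=(E-e,\{F\in\mathcal F: e\notin F\})$; if $e$ is a loop or a coloop, whichever of $S/e$, $S\setminus e$ is undefined is set equal to the other. For $A\subseteq E$, the loop complementation $S+A$ is the set system on $E$ in which $F\subseteq E$ is feasible if and only if $S$ has an odd number of feasible sets $F'$ with $F-A\subseteq F'\subseteq F$ (write $S+e$ for $S+\{e\}$). The Penrose contraction of $e$ is $S\ddagger e=(S+e)/e$. A $3$-minor of $S$ is any set system obtained from $S$ by a finite (possibly empty) sequence of single-element deletions, contractions and Penrose contractions. -}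

module Defs where

open import Data.Bool using (Bool; true; false; _∧_; not; if_then_else_)
open import Data.Nat using (ℕ; zero; suc)
open import Data.Fin using (Fin)
open import Data.Fin.Subset using (Subset; _∈_; _⊆_; _∪_; _─_; _-_; ⁅_⁆; ⊥)
open import Data.Fin.Subset.Properties using (_∈?_; _⊆?_)
open import Data.List using (List; []; _∷_; _++_; map; filter; length; foldr)
open import Data.Vec using (Vec; []; _∷_)
open import Data.Product using (Σ; _×_; _,_; ∃)
open import Relation.Nullary.Decidable using (⌊_⌋)
open import Relation.Binary.PropositionalEquality using (_≡_)

-- A set system is a ground set E ⊆ Fin n together
-- with a Boolean predicate on subsets; the feasible sets are exactly the
-- subsets F ⊆ E with feas F ≡ true (values of feas outside E are ignored).
record SetSys (n : ℕ) : Set where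
  field
    ground : Subset n
    feas   : Subset n → Bool
open SetSys public

subsets : (n : ℕ) → List (Subset n)
subsets zero    = [] ∷ []
subsets (suc n) = map (false ∷_) (subsets n) ++ map (true ∷_) (subsets n)

count : {n : ℕ} → (Subset n → Bool) → ℕ
count {n} p = length (filter (λ F → p F Data.Bool.≟ true) (subsets n))
  where import Data.Bool

isOdd : ℕ → Bool
isOdd zero    = false
isOdd (suc k) = not (isOdd k)

isFeas : {n : ℕ} → SetSys n → Subset n → Bool
isFeas S F = ⌊ F ⊆? ground S ⌋ ∧ feas S F

Feasible : {n : ℕ} → SetSys n → Subset n → Set
Feasible S F = F ⊆ ground S × feas S F ≡ true

Proper : {n : ℕ} → SetSys n → Set
Proper {n} S = ∃ λ (F : Subset n) → Feasible S F

_≈_ : {n : ℕ} → SetSys n → SetSys n → Set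
S ≈ T = ground S ≡ ground T × (∀ F → isFeas S F ≡ isFeas T F)

_∈ᵇ_ : {n : ℕ} → Fin n → Subset n → Bool
e ∈ᵇ F = ⌊ e ∈? F ⌋

isLoop : {n : ℕ} → SetSys n → Fin n → Bool
isLoop {n} S e = isZero (count (λ F → isFeas S F ∧ (e ∈ᵇ F)))
  where
  isZero : ℕ → Bool
  isZero zero = true
  isZero (suc _) = false

isColoop : {n : ℕ} → SetSys n → Fin n → Bool
isColoop {n} S e = isZero (count (λ F → isFeas S F ∧ not (e ∈ᵇ F)))
  where
  isZero : ℕ → Bool
  isZero zero = true
  isZero (suc _) = false

rawDel : {n : ℕ} → SetSys n → Fin n → SetSys n
rawDel S e = record { ground = ground S - e
                    ; feas = λ G → not (e ∈ᵇ G) ∧ isFeas S G }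

rawCon : {n : ℕ} → SetSys n → Fin n → SetSys n
rawCon S e = record { ground = ground S - e
                    ; feas = λ G → not (e ∈ᵇ G) ∧ isFeas S (G ∪ ⁅ e ⁆) }

del : {n : ℕ} → SetSys n → Fin n → SetSys n
del S e = if isColoop S e then rawCon S e else rawDel S e

con : {n : ℕ} → SetSys n → Fin n → SetSys n
con S e = if isLoop S e then rawDel S e else rawCon S e

loopCompl : {n : ℕ} → SetSys n → Subset n → SetSys n
loopCompl S A = record
  { ground = ground S
  ; feas = λ F → isOdd (count (λ F' → isFeas S F' ∧ (⌊ (F ─ A) ⊆? F' ⌋ ∧ ⌊ F' ⊆? F ⌋))) }

pen : {n : ℕ} → SetSys n → Fin n → SetSys n
pen S e = con (loopCompl S ⁅ e ⁆) e

data Minor3 {n : ℕ} (S : SetSys n) : SetSys n → Set where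
  done    : Minor3 S S
  stepDel : ∀ {T} e → e ∈ ground T → Minor3 S T → Minor3 S (del T e)
  stepCon : ∀ {T} e → e ∈ ground T → Minor3 S T → Minor3 S (con T e)
  stepPen : ∀ {T} e → e ∈ ground T → Minor3 S T → Minor3 S (pen T e)

applyAll : {n : ℕ} → (SetSys n → Fin n → SetSys n) → SetSys n → List (Fin n) → SetSys n
applyAll op S []       = S
applyAll op S (x ∷ xs) = applyAll op (op S x) xs

toSubset : {n : ℕ} → List (Fin n) → Subset n
toSubset = foldr (λ x A → ⁅ x ⁆ ∪ A) ⊥

module Submission where

-- For X, Y, Z ⊆ E, `canonical S X Y Z` has ground set E − (X ∪ Y ∪ Z), and G
-- is feasible iff S has an odd number of feasible sets in [G ∪ Y, G ∪ Y ∪ Z].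
-- Parities of counts over intervals are computed coordinatewise (`parity`);
-- the interval [A, A] counts A alone, and [L, U ∪ {e}] splits into [L, U] and
-- [L ∪ {e}, U ∪ {e}].  Hence any of the three operations, applied to a
-- canonical minor at e, yields the canonical minor with e added to X, Y or Z
-- (which one depends on e being a loop or coloop), so by induction every
-- 3-minor has a canonical form (`canonical-form`), and it is proper because S
-- is (`minor-proper`).  Conversely, if the canonical minor is proper, each
-- step of the sequence delete-contract-Penrose-contract is nondegenerate, so
-- the sequence reaches exactly this canonical minor (`Phase`); its properness
-- is the required odd count.

open import Defs
open import Data.Bool using (Bool; true; false; _∧_; _xor_; not; _≟_)
open import Data.Bool.Properties using (∧-zeroʳ; not-distribˡ-xor; xor-identityʳ; xor-∧-commutativeRing)
open import Data.Nat using (ℕ; zero; suc; _+_)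
open import Data.Fin using (Fin; zero; suc)
open import Data.Fin.Subset using (Subset; _∈_; _∉_; _⊆_; _∪_; _─_; _-_; ⁅_⁆; ⊥)
open import Data.Fin.Subset.Properties
  using (_∈?_; _⊆?_; drop-there; drop-not-there; ∉⊥; x∈⁅x⁆; x∈⁅y⁆⇒x≡y; x∈p∪q⁺; x∈p∪q⁻;
         x∈p∧x∉q⇒x∈p─q; p─q⊆p; p─⊥≡p; p─q─r≡p─q∪r; ∪-identityʳ; ∪-identityˡ; ∪-assoc;
         ∪-commutativeMonoid)
open import Data.List using (List; []; _∷_; _++_; _∷ʳ_; map; filter; length)
open import Data.List.Properties using (filter-++; length-++; ++-assoc)
open import Data.List.Membership.Propositional using () renaming (_∈_ to _∈ₗ_)
open import Data.List.Membership.Propositional.Properties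
  using (∈-map⁺; ∈-++⁺ˡ; ∈-++⁺ʳ; ∈-filter⁺; ∈-filter⁻)
open import Data.List.Relation.Unary.Any using () renaming (here to hereₗ; there to thereₗ)
open import Data.List.Relation.Unary.All using (All; []; _∷_; head)
open import Data.List.Relation.Unary.All.Properties
  using (¬Any⇒All¬) renaming (++⁻ˡ to All-++⁻ˡ; ++⁻ʳ to All-++⁻ʳ)
open import Data.List.Relation.Unary.AllPairs using ([]; _∷_)
open import Data.List.Relation.Unary.Unique.Propositional using (Unique)
open import Data.List.Relation.Unary.Unique.Propositional.Properties using (Unique[x∷xs]⇒x∉xs)
open import Data.List.Relation.Binary.Permutation.Propositional using (_↭_; ↭-sym; ↭⇒↭ₛ)
open import Data.List.Relation.Binary.Permutation.Propositional.Properties using (shift; ∷↭∷ʳ; All-resp-↭)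
import Data.List.Relation.Binary.Permutation.Setoid.Properties as PermutationSetoid
open import Data.List.Reverse using (Reverse; []; _∶_∶ʳ_; reverseView)
open import Data.Vec using (_∷_; []; here; there)
open import Data.Product using (Σ; ∃; _×_; _,_; proj₁; proj₂)
open import Data.Sum using (_⊎_; inj₁; inj₂)
open import Data.Empty using (⊥-elim)
open import Function using (_∘_)
open import Relation.Nullary using (¬_; Dec; yes; no; does; contradiction)
open import Relation.Nullary.Decidable using (⌊_⌋; isYes≗does)
open import Relation.Unary using (Decidable)
open import Relation.Binary.PropositionalEquality
open import Algebra.Bundles using (CommutativeRing)
import Algebra.Properties.CommutativeSemigroup as CommutativeSemigroupProperties
import Algebra.Solver.CommutativeMonoid as CommutativeMonoidSolver

open CommutativeSemigroupProperties (CommutativeRing.+-commutativeSemigroup xor-∧-commutativeRing)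
  using () renaming (interchange to xor-interchange)

private
  variable
    n : ℕ

-- Counting subsets, and the parity of counts over intervals.

holds : {A : Set} (p : A → Bool) → Decidable (λ x → p x ≡ true)
holds p x = p x ≟ true

#⟨_⟩ : {A : Set} → (A → Bool) → List A → ℕ
#⟨ p ⟩ xs = length (filter (holds p) xs)

#-++ : {A : Set} (p : A → Bool) (xs ys : List A) → #⟨ p ⟩ (xs ++ ys) ≡ #⟨ p ⟩ xs + #⟨ p ⟩ ys
#-++ p xs ys = trans (cong length (filter-++ (holds p) xs ys)) (length-++ (filter (holds p) xs))

#-map : {A B : Set} (p : B → Bool) (f : A → B) (xs : List A) → #⟨ p ⟩ (map f xs) ≡ #⟨ (λ x → p (f x)) ⟩ xs
#-map p f [] = refl
#-map p f (x ∷ xs) with p (f x)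
... | true  = cong suc (#-map p f xs)
... | false = #-map p f xs

#-cong : {A : Set} {p q : A → Bool} → (∀ x → p x ≡ q x) → (xs : List A) → #⟨ p ⟩ xs ≡ #⟨ q ⟩ xs
#-cong h [] = refl
#-cong {q = q} h (x ∷ xs) rewrite h x with q x
... | true  = cong suc (#-cong h xs)
... | false = #-cong h xs

subsets-complete : (F : Subset n) → F ∈ₗ subsets n
subsets-complete [] = hereₗ refl
subsets-complete {suc n} (false ∷ F) = ∈-++⁺ˡ (∈-map⁺ (false ∷_) (subsets-complete F))
subsets-complete {suc n} (true ∷ F) =
  ∈-++⁺ʳ (map (false ∷_) (subsets n)) (∈-map⁺ (true ∷_) (subsets-complete F))

count-split : (p : Subset (suc n) → Bool) →
  count p ≡ count (λ F → p (false ∷ F)) + count (λ F → p (true ∷ F))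
count-split {n} p = trans (#-++ p (map (false ∷_) (subsets n)) _)
  (cong₂ _+_ (#-map p (false ∷_) (subsets n)) (#-map p (true ∷_) (subsets n)))

count-cong : {p q : Subset n → Bool} → (∀ F → p F ≡ q F) → count p ≡ count q
count-cong {n} h = #-cong h (subsets n)

count-none : (p : Subset n → Bool) → count p ≡ 0 → ∀ F → p F ≡ false
count-none {n} p h F with p F in pF
... | false = refl
... | true  = contradiction h (nonempty (∈-filter⁺ (holds p) (subsets-complete F) pF))
  where
  nonempty : {A : Set} {x : A} {xs : List A} → x ∈ₗ xs → length xs ≢ 0
  nonempty (hereₗ _)  ()
  nonempty (thereₗ _) ()

count-some : (p : Subset n → Bool) {k : ℕ} → count p ≡ suc k → ∃ λ F → p F ≡ true
count-some {n} p h with filter (holds p) (subsets n) in eq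
... | F ∷ _ = F , proj₂ (∈-filter⁻ (holds p) {xs = subsets n} (subst (F ∈ₗ_) (sym eq) (hereₗ refl)))

isOdd-+ : (a b : ℕ) → isOdd (a + b) ≡ isOdd a xor isOdd b
isOdd-+ zero    b = refl
isOdd-+ (suc a) b = trans (cong not (isOdd-+ a b)) (not-distribˡ-xor (isOdd a) (isOdd b))

oddCount-split : (p : Subset (suc n) → Bool) →
  isOdd (count p) ≡ isOdd (count (λ F → p (false ∷ F))) xor isOdd (count (λ F → p (true ∷ F)))
oddCount-split p = trans (cong isOdd (count-split p)) (isOdd-+ (count (λ F → p (false ∷ F))) _)

oddCount-cong : {p q : Subset n → Bool} → (∀ F → p F ≡ q F) → isOdd (count p) ≡ isOdd (count q)
oddCount-cong h = cong isOdd (count-cong h)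

oddCount-none : (p : Subset n → Bool) → (∀ F → p F ≡ false) → isOdd (count p) ≡ false
oddCount-none {zero} p h rewrite h [] = refl
oddCount-none {suc n} p h = trans (oddCount-split p) (
  cong₂ _xor_ (oddCount-none _ (λ F → h (false ∷ F))) (oddCount-none _ (λ F → h (true ∷ F))))

-- parity p L U is the parity of the number of subsets F with L ⊆ F ⊆ U and
-- p F, computed coordinate by coordinate.
parity : (Subset n → Bool) → Subset n → Subset n → Bool
parity p []          []          = p []
parity p (true ∷ L)  (true ∷ U)  = parity (λ F → p (true ∷ F)) L U
parity p (true ∷ L)  (false ∷ U) = false
parity p (false ∷ L) (true ∷ U)  = parity (λ F → p (false ∷ F)) L U xor parity (λ F → p (true ∷ F)) L U
parity p (false ∷ L) (false ∷ U) = parity (λ F → p (false ∷ F)) L U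

-- Boolean inclusion that computes structurally.
_⊆ᵇ_ : Subset n → Subset n → Bool
L ⊆ᵇ U = does (L ⊆? U)

_within[_,_] : (Subset n → Bool) → Subset n → Subset n → Subset n → Bool
(p within[ L , U ]) F = p F ∧ (L ⊆ᵇ F ∧ F ⊆ᵇ U)

∧-falseʳ : (a b : Bool) → a ∧ (b ∧ false) ≡ false
∧-falseʳ a b = trans (cong (a ∧_) (∧-zeroʳ b)) (∧-zeroʳ a)

oddCount-interval : (p : Subset n → Bool) (L U : Subset n) →
  isOdd (count (p within[ L , U ])) ≡ parity p L U
oddCount-interval p [] [] with p []
... | true  = refl
... | false = refl
oddCount-interval p (true ∷ L) (true ∷ U) =
  trans (oddCount-split (p within[ true ∷ L , true ∷ U ])) (cong₂ _xor_
    (oddCount-none _ (λ F → ∧-zeroʳ (p (false ∷ F))))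
    (oddCount-interval _ L U))
oddCount-interval p (true ∷ L) (false ∷ U) =
  trans (oddCount-split (p within[ true ∷ L , false ∷ U ])) (cong₂ _xor_
    (oddCount-none _ (λ F → ∧-zeroʳ (p (false ∷ F))))
    (oddCount-none _ (λ F → ∧-falseʳ (p (true ∷ F)) (L ⊆ᵇ F))))
oddCount-interval p (false ∷ L) (true ∷ U) =
  trans (oddCount-split (p within[ false ∷ L , true ∷ U ]))
    (cong₂ _xor_ (oddCount-interval _ L U) (oddCount-interval _ L U))
oddCount-interval p (false ∷ L) (false ∷ U) =
  trans (oddCount-split (p within[ false ∷ L , false ∷ U ])) (trans (cong₂ _xor_
    (oddCount-interval _ L U)
    (oddCount-none _ (λ F → ∧-falseʳ (p (true ∷ F)) (L ⊆ᵇ F))))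
    (xor-identityʳ _))

parity-point : (p : Subset n → Bool) (A : Subset n) → parity p A A ≡ p A
parity-point p []          = refl
parity-point p (true ∷ A)  = parity-point (λ F → p (true ∷ F)) A
parity-point p (false ∷ A) = parity-point (λ F → p (false ∷ F)) A

parity-split : (p : Subset n → Bool) (e : Fin n) (L U : Subset n) → e ∉ L → e ∉ U →
  parity p L (U ∪ ⁅ e ⁆) ≡ parity p L U xor parity p (L ∪ ⁅ e ⁆) (U ∪ ⁅ e ⁆)
parity-split p zero (true ∷ L) U e∉L e∉U = ⊥-elim (e∉L here)
parity-split p zero (false ∷ L) (true ∷ U) e∉L e∉U = ⊥-elim (e∉U here)
parity-split p zero (false ∷ L) (false ∷ U) e∉L e∉U
  rewrite ∪-identityʳ L | ∪-identityʳ U = refl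
parity-split p (suc e) (true ∷ L) (true ∷ U) e∉L e∉U =
  parity-split _ e L U (drop-not-there e∉L) (drop-not-there e∉U)
parity-split p (suc e) (true ∷ L) (false ∷ U) e∉L e∉U = refl
parity-split p (suc e) (false ∷ L) (true ∷ U) e∉L e∉U
  rewrite parity-split (λ F → p (false ∷ F)) e L U (drop-not-there e∉L) (drop-not-there e∉U)
        | parity-split (λ F → p (true ∷ F)) e L U (drop-not-there e∉L) (drop-not-there e∉U)
  = xor-interchange (parity p₀ L U) (parity p₀ (L ∪ ⁅ e ⁆) (U ∪ ⁅ e ⁆))
                    (parity p₁ L U) (parity p₁ (L ∪ ⁅ e ⁆) (U ∪ ⁅ e ⁆))
  where
  p₀ p₁ : Subset _ → Bool
  p₀ F = p (false ∷ F)
  p₁ F = p (true ∷ F)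
parity-split p (suc e) (false ∷ L) (false ∷ U) e∉L e∉U =
  parity-split _ e L U (drop-not-there e∉L) (drop-not-there e∉U)

⌊⌋-yes : {A : Set} (a? : Dec A) → A → ⌊ a? ⌋ ≡ true
⌊⌋-yes (yes _) _ = refl
⌊⌋-yes (no ¬a) a = contradiction a ¬a

⌊⌋-no : {A : Set} (a? : Dec A) → ¬ A → ⌊ a? ⌋ ≡ false
⌊⌋-no (yes a) ¬a = contradiction a ¬a
⌊⌋-no (no _)  _  = refl

⌊⌋-sound : {A : Set} (a? : Dec A) → ⌊ a? ⌋ ≡ true → A
⌊⌋-sound (yes a) _ = a

∈ᵇ-yes : {e : Fin n} {G : Subset n} → e ∈ G → e ∈ᵇ G ≡ true
∈ᵇ-yes {e = e} {G} = ⌊⌋-yes (e ∈? G)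

∈ᵇ-no : {e : Fin n} {G : Subset n} → e ∉ G → e ∈ᵇ G ≡ false
∈ᵇ-no {e = e} {G} = ⌊⌋-no (e ∈? G)

x∈p─q⇒x∉q : {x : Fin n} (p q : Subset n) → x ∈ p ─ q → x ∉ q
x∈p─q⇒x∉q {x = zero}  (true ∷ p)  (true ∷ q)  ()
x∈p─q⇒x∉q {x = zero}  (a ∷ p)     (false ∷ q) _           ()
x∈p─q⇒x∉q {x = suc x} (a ∷ p)     (b ∷ q)     (there x∈) x∈q = x∈p─q⇒x∉q p q x∈ (drop-there x∈q)

─-∉ : {e : Fin n} (G : Subset n) → e ∉ G → G - e ≡ G
─-∉ {e = zero}  (true ∷ G)  e∉ = ⊥-elim (e∉ here)
─-∉ {e = zero}  (false ∷ G) e∉ = cong (false ∷_) (p─⊥≡p G)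
─-∉ {e = suc e} (true ∷ G)  e∉ = cong (true ∷_) (─-∉ G (drop-not-there e∉))
─-∉ {e = suc e} (false ∷ G) e∉ = cong (false ∷_) (─-∉ G (drop-not-there e∉))

∪─-∉ : {e : Fin n} (G : Subset n) → e ∉ G → (G ∪ ⁅ e ⁆) - e ≡ G
∪─-∉ {e = zero}  (true ∷ G)  e∉ = ⊥-elim (e∉ here)
∪─-∉ {e = zero}  (false ∷ G) e∉ = cong (false ∷_) (trans (p─⊥≡p (G ∪ ⊥)) (∪-identityʳ G))
∪─-∉ {e = suc e} (true ∷ G)  e∉ = cong (true ∷_) (∪─-∉ G (drop-not-there e∉))
∪─-∉ {e = suc e} (false ∷ G) e∉ = cong (false ∷_) (∪─-∉ G (drop-not-there e∉))

─∪-∈ : {e : Fin n} (G : Subset n) → e ∈ G → (G - e) ∪ ⁅ e ⁆ ≡ G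
─∪-∈ {e = zero}  (true ∷ G)  here       = cong (true ∷_) (trans (∪-identityʳ (G ─ ⊥)) (p─⊥≡p G))
─∪-∈ {e = suc e} (true ∷ G)  (there e∈) = cong (true ∷_) (─∪-∈ G e∈)
─∪-∈ {e = suc e} (false ∷ G) (there e∈) = cong (false ∷_) (─∪-∈ G e∈)

∉-─ : {e : Fin n} {G W : Subset n} → G ⊆ W - e → e ∉ G
∉-─ {e = e} {G} {W} G⊆ e∈G = x∈p─q⇒x∉q W ⁅ e ⁆ (G⊆ e∈G) (x∈⁅x⁆ e)

⊆-─ : {G W A : Subset n} → G ⊆ W ─ A → G ⊆ W
⊆-─ {W = W} {A} G⊆ = p─q⊆p W A ∘ G⊆

∉-self : (G : Subset n) (e : Fin n) → e ∉ G - e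
∉-self G e = ∉-─ {G = G - e} (λ x∈ → x∈)

∪⁅⁆-⊆ : {e : Fin n} {G W : Subset n} → G ⊆ W - e → e ∈ W → G ∪ ⁅ e ⁆ ⊆ W
∪⁅⁆-⊆ {e = e} {G} {W} G⊆ e∈W x∈ with x∈p∪q⁻ G ⁅ e ⁆ x∈
... | inj₁ x∈G = ⊆-─ G⊆ x∈G
... | inj₂ x∈e = subst (_∈ W) (sym (x∈⁅y⁆⇒x≡y e x∈e)) e∈W

∉-∪ : {e : Fin n} {A B : Subset n} → e ∉ A → e ∉ B → e ∉ A ∪ B
∉-∪ {A = A} {B} e∉A e∉B e∈ with x∈p∪q⁻ A B e∈
... | inj₁ e∈A = e∉A e∈A
... | inj₂ e∈B = e∉B e∈B

module ∪-Solver {n : ℕ} = CommutativeMonoidSolver (∪-commutativeMonoid n)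

private
  variable
    S T U : SetSys n

isFeas-⊆ : {G : Subset n} → G ⊆ ground T → isFeas T G ≡ feas T G
isFeas-⊆ {T = T} {G} G⊆ = cong (_∧ feas T G) (⌊⌋-yes (G ⊆? ground T) G⊆)

isFeas-⊈ : {G : Subset n} → ¬ G ⊆ ground T → isFeas T G ≡ false
isFeas-⊈ {T = T} {G} G⊈ = cong (_∧ feas T G) (⌊⌋-no (G ⊆? ground T) G⊈)

feasible⇒isFeas : {F : Subset n} → Feasible T F → isFeas T F ≡ true
feasible⇒isFeas {T = T} (F⊆ , fF) = trans (isFeas-⊆ {T = T} F⊆) fF

isFeas⇒feasible : {F : Subset n} → isFeas T F ≡ true → Feasible T F
isFeas⇒feasible {T = T} {F} h with F ⊆? ground T
... | yes F⊆ = F⊆ , h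
... | no  _  = contradiction h λ ()

proper-intro : {F : Subset n} → isFeas T F ≡ true → Proper T
proper-intro {T = T} {F} h = F , isFeas⇒feasible {T = T} h

≈-refl : T ≈ T
≈-refl = refl , λ _ → refl

≈-reflexive : T ≡ U → T ≈ U
≈-reflexive refl = ≈-refl

≈-sym : T ≈ U → U ≈ T
≈-sym (g , f) = sym g , λ F → sym (f F)

≈-trans : {V : SetSys n} → T ≈ U → U ≈ V → T ≈ V
≈-trans (g , f) (g′ , f′) = trans g g′ , λ F → trans (f F) (f′ F)

≈-intro : ground T ≡ ground U → (∀ G → G ⊆ ground T → feas T G ≡ feas U G) → T ≈ U
≈-intro {T = T} {U} g h = g , λ G → compare G (G ⊆? ground T)
  where
  compare : ∀ G → Dec (G ⊆ ground T) → isFeas T G ≡ isFeas U G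
  compare G (yes G⊆) =
    trans (isFeas-⊆ {T = T} G⊆) (trans (h G G⊆) (sym (isFeas-⊆ {T = U} (subst (G ⊆_) g G⊆))))
  compare G (no G⊈)  = trans (isFeas-⊈ {T = T} G⊈) (sym (isFeas-⊈ {T = U} (G⊈ ∘ subst (G ⊆_) (sym g))))

≈-feas : T ≈ U → {G : Subset n} → G ⊆ ground T → isFeas T G ≡ feas U G
≈-feas {U = U} (g , f) {G} G⊆ = trans (f G) (isFeas-⊆ {T = U} (subst (G ⊆_) g G⊆))

proper-≈ : T ≈ U → Proper T → Proper U
proper-≈ {T = T} {U} (g , f) (F , fF) = proper-intro {T = U} (trans (sym (f F)) (feasible⇒isFeas {T = T} fF))

∧-elimˡ : {a b : Bool} → a ∧ b ≡ true → a ≡ true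
∧-elimˡ {true} _ = refl

∧-elimʳ : {a b : Bool} → a ∧ b ≡ true → b ≡ true
∧-elimʳ {true} h = h

-- Parity of feasible sets in an interval.

-- oddIn T L U: T has an odd number of feasible sets F with L ⊆ F ⊆ U.  Both
-- loop complementation and the canonical minors below are defined by it.
oddIn : SetSys n → Subset n → Subset n → Bool
oddIn T L U = isOdd (count (λ F → isFeas T F ∧ (⌊ L ⊆? F ⌋ ∧ ⌊ F ⊆? U ⌋)))

oddIn-parity : (T : SetSys n) (L U : Subset n) → oddIn T L U ≡ parity (isFeas T) L U
oddIn-parity T L U = trans
  (oddCount-cong λ F →
    cong₂ (λ a b → isFeas T F ∧ (a ∧ b)) (isYes≗does (L ⊆? F)) (isYes≗does (F ⊆? U)))
  (oddCount-interval (isFeas T) L U)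

oddIn-point : (T : SetSys n) (A : Subset n) → oddIn T A A ≡ isFeas T A
oddIn-point T A = trans (oddIn-parity T A A) (parity-point (isFeas T) A)

oddIn-split : (T : SetSys n) (e : Fin n) (L U : Subset n) → e ∉ L → e ∉ U →
  oddIn T L (U ∪ ⁅ e ⁆) ≡ oddIn T L U xor oddIn T (L ∪ ⁅ e ⁆) (U ∪ ⁅ e ⁆)
oddIn-split T e L U e∉L e∉U = begin
  oddIn T L (U ∪ ⁅ e ⁆)
    ≡⟨ oddIn-parity T L _ ⟩
  parity (isFeas T) L (U ∪ ⁅ e ⁆)
    ≡⟨ parity-split (isFeas T) e L U e∉L e∉U ⟩
  parity (isFeas T) L U xor parity (isFeas T) (L ∪ ⁅ e ⁆) (U ∪ ⁅ e ⁆)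
    ≡⟨ sym (cong₂ _xor_ (oddIn-parity T L U) (oddIn-parity T _ _)) ⟩
  oddIn T L U xor oddIn T (L ∪ ⁅ e ⁆) (U ∪ ⁅ e ⁆) ∎
  where open ≡-Reasoning

oddIn-proper : (T : SetSys n) {L U : Subset n} → oddIn T L U ≡ true → Proper T
oddIn-proper T {L} {U} h with count (λ F → isFeas T F ∧ (⌊ L ⊆? F ⌋ ∧ ⌊ F ⊆? U ⌋)) in c
... | zero  = contradiction h λ ()
... | suc _ with count-some (λ F → isFeas T F ∧ (⌊ L ⊆? F ⌋ ∧ ⌊ F ⊆? U ⌋)) c
...   | F , hF = proper-intro {T = T} {F} (∧-elimˡ hF)

_+ₑ_ : SetSys n → Fin n → SetSys n
T +ₑ e = loopCompl T ⁅ e ⁆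

penrose-avoid : (T : SetSys n) (e : Fin n) {G : Subset n} → e ∉ G → isFeas (T +ₑ e) G ≡ isFeas T G
penrose-avoid T e {G} e∉G with G ⊆? ground T
... | no _  = refl
... | yes G⊆ = begin
  true ∧ oddIn T (G - e) G ≡⟨ cong (λ L → oddIn T L G) (─-∉ G e∉G) ⟩
  oddIn T G G             ≡⟨ oddIn-point T G ⟩
  isFeas T G              ≡⟨ isFeas-⊆ {T = T} G⊆ ⟩
  feas T G                ∎
  where open ≡-Reasoning

penrose-add : (T : SetSys n) (e : Fin n) {G : Subset n} → e ∉ G →
  feas (T +ₑ e) (G ∪ ⁅ e ⁆) ≡ isFeas T G xor isFeas T (G ∪ ⁅ e ⁆)
penrose-add T e {G} e∉G = begin
  oddIn T ((G ∪ ⁅ e ⁆) - e) (G ∪ ⁅ e ⁆)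
    ≡⟨ cong (λ L → oddIn T L (G ∪ ⁅ e ⁆)) (∪─-∉ G e∉G) ⟩
  oddIn T G (G ∪ ⁅ e ⁆)
    ≡⟨ oddIn-split T e G G e∉G e∉G ⟩
  oddIn T G G xor oddIn T (G ∪ ⁅ e ⁆) (G ∪ ⁅ e ⁆)
    ≡⟨ cong₂ _xor_ (oddIn-point T G) (oddIn-point T (G ∪ ⁅ e ⁆)) ⟩
  isFeas T G xor isFeas T (G ∪ ⁅ e ⁆) ∎
  where open ≡-Reasoning

penrose-del : (T : SetSys n) (e : Fin n) → rawDel (T +ₑ e) e ≈ rawDel T e
penrose-del T e = ≈-intro refl λ G G⊆ → cong (not (e ∈ᵇ G) ∧_) (penrose-avoid T e (∉-─ G⊆))

canonical : SetSys n → Subset n → Subset n → Subset n → SetSys n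
canonical S X Y Z = record
  { ground = ground S ─ (X ∪ Y ∪ Z)
  ; feas   = λ G → oddIn S (G ∪ Y) (G ∪ Y ∪ Z) }

canonical-empty : (S : SetSys n) → S ≈ canonical S ⊥ ⊥ ⊥
canonical-empty S = ≈-intro ground-eq λ G G⊆ → sym (begin
  oddIn S (G ∪ ⊥) (G ∪ ⊥ ∪ ⊥) ≡⟨ cong₂ (oddIn S) (∪-identityʳ G)
                                    (trans (cong (G ∪_) (∪-identityʳ ⊥)) (∪-identityʳ G)) ⟩
  oddIn S G G                 ≡⟨ oddIn-point S G ⟩
  isFeas S G                  ≡⟨ isFeas-⊆ {T = S} G⊆ ⟩
  feas S G                    ∎)
  where
  open ≡-Reasoning
  ground-eq : ground S ≡ ground S ─ (⊥ ∪ ⊥ ∪ ⊥)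
  ground-eq = sym (trans (cong (ground S ─_) (trans (∪-identityˡ (⊥ ∪ ⊥)) (∪-identityˡ ⊥)))
                         (p─⊥≡p (ground S)))

canonical-∉ : (S : SetSys n) (X Y Z : Subset n) {e : Fin n} → e ∈ ground (canonical S X Y Z) →
  e ∉ Y × e ∉ Z
canonical-∉ S X Y Z {e} e∈ =
  (λ e∈Y → e∉ (x∈p∪q⁺ (inj₂ (x∈p∪q⁺ (inj₁ e∈Y))))) ,
  (λ e∈Z → e∉ (x∈p∪q⁺ (inj₂ (x∈p∪q⁺ (inj₂ e∈Z)))))
  where
  e∉ : e ∉ X ∪ Y ∪ Z
  e∉ = x∈p─q⇒x∉q (ground S) (X ∪ Y ∪ Z) e∈

module _ {S T : SetSys n} {X Y Z : Subset n} (T≈ : T ≈ canonical S X Y Z) (e : Fin n) where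
  open ∪-Solver using (solve; _⊜_; _⊕_)
  open ≡-Reasoning

  private
    ground-shift : ∀ D′ → (X ∪ Y ∪ Z) ∪ ⁅ e ⁆ ≡ D′ → ground T - e ≡ ground S ─ D′
    ground-shift D′ eq =
      trans (cong (_- e) (proj₁ T≈))
            (trans (p─q─r≡p─q∪r (ground S) (X ∪ Y ∪ Z) ⁅ e ⁆) (cong (ground S ─_) eq))

  rawDel-canonical : rawDel T e ≈ canonical S (⁅ e ⁆ ∪ X) Y Z
  rawDel-canonical = ≈-intro
    (ground-shift _ (solve 4 (λ x y z e → (x ⊕ y ⊕ z) ⊕ e ⊜ (e ⊕ x) ⊕ y ⊕ z) refl X Y Z ⁅ e ⁆))
    λ G G⊆ → begin
      not (e ∈ᵇ G) ∧ isFeas T G ≡⟨ cong (λ b → not b ∧ isFeas T G) (∈ᵇ-no (∉-─ G⊆)) ⟩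
      isFeas T G                ≡⟨ ≈-feas T≈ (⊆-─ G⊆) ⟩
      oddIn S (G ∪ Y) (G ∪ Y ∪ Z) ∎

  rawCon-canonical : e ∈ ground T → rawCon T e ≈ canonical S X (⁅ e ⁆ ∪ Y) Z
  rawCon-canonical e∈ = ≈-intro
    (ground-shift _ (solve 4 (λ x y z e → (x ⊕ y ⊕ z) ⊕ e ⊜ x ⊕ (e ⊕ y) ⊕ z) refl X Y Z ⁅ e ⁆))
    λ G G⊆ → begin
      not (e ∈ᵇ G) ∧ isFeas T (G ∪ ⁅ e ⁆)
        ≡⟨ cong (λ b → not b ∧ isFeas T (G ∪ ⁅ e ⁆)) (∈ᵇ-no (∉-─ G⊆)) ⟩
      isFeas T (G ∪ ⁅ e ⁆)
        ≡⟨ ≈-feas T≈ (∪⁅⁆-⊆ G⊆ e∈) ⟩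
      oddIn S ((G ∪ ⁅ e ⁆) ∪ Y) ((G ∪ ⁅ e ⁆) ∪ Y ∪ Z)
        ≡⟨ cong₂ (oddIn S)
             (solve 3 (λ g e y → (g ⊕ e) ⊕ y ⊜ g ⊕ e ⊕ y) refl G ⁅ e ⁆ Y)
             (solve 4 (λ g e y z → (g ⊕ e) ⊕ y ⊕ z ⊜ g ⊕ (e ⊕ y) ⊕ z) refl G ⁅ e ⁆ Y Z) ⟩
      oddIn S (G ∪ ⁅ e ⁆ ∪ Y) (G ∪ (⁅ e ⁆ ∪ Y) ∪ Z) ∎

  -- Penrose contraction, computed as contraction of T + e: the parities over
  -- [G ∪ Y, G ∪ Y ∪ Z] and [G ∪ Y ∪ {e}, G ∪ Y ∪ Z ∪ {e}] add up to the
  -- parity over [G ∪ Y, G ∪ Y ∪ Z ∪ {e}].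
  rawPen-canonical : e ∈ ground T → rawCon (T +ₑ e) e ≈ canonical S X Y (⁅ e ⁆ ∪ Z)
  rawPen-canonical e∈ = ≈-intro
    (ground-shift _ (solve 4 (λ x y z e → (x ⊕ y ⊕ z) ⊕ e ⊜ x ⊕ y ⊕ e ⊕ z) refl X Y Z ⁅ e ⁆))
    λ G G⊆ → let e∉G = ∉-─ G⊆ in begin
      not (e ∈ᵇ G) ∧ isFeas (T +ₑ e) (G ∪ ⁅ e ⁆)
        ≡⟨ cong (λ b → not b ∧ isFeas (T +ₑ e) (G ∪ ⁅ e ⁆)) (∈ᵇ-no e∉G) ⟩
      isFeas (T +ₑ e) (G ∪ ⁅ e ⁆)
        ≡⟨ isFeas-⊆ {T = T +ₑ e} (∪⁅⁆-⊆ G⊆ e∈) ⟩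
      feas (T +ₑ e) (G ∪ ⁅ e ⁆)
        ≡⟨ penrose-add T e e∉G ⟩
      isFeas T G xor isFeas T (G ∪ ⁅ e ⁆)
        ≡⟨ cong₂ _xor_ (≈-feas T≈ (⊆-─ G⊆)) (≈-feas T≈ (∪⁅⁆-⊆ G⊆ e∈)) ⟩
      oddIn S (G ∪ Y) (G ∪ Y ∪ Z) xor oddIn S ((G ∪ ⁅ e ⁆) ∪ Y) ((G ∪ ⁅ e ⁆) ∪ Y ∪ Z)
        ≡⟨ cong (oddIn S (G ∪ Y) (G ∪ Y ∪ Z) xor_) (cong₂ (oddIn S)
             (solve 3 (λ g e y → (g ⊕ e) ⊕ y ⊜ (g ⊕ y) ⊕ e) refl G ⁅ e ⁆ Y)
             (solve 4 (λ g e y z → (g ⊕ e) ⊕ y ⊕ z ⊜ (g ⊕ y ⊕ z) ⊕ e) refl G ⁅ e ⁆ Y Z)) ⟩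
      oddIn S (G ∪ Y) (G ∪ Y ∪ Z) xor oddIn S ((G ∪ Y) ∪ ⁅ e ⁆) ((G ∪ Y ∪ Z) ∪ ⁅ e ⁆)
        ≡⟨ sym (oddIn-split S e (G ∪ Y) (G ∪ Y ∪ Z) (∉-∪ e∉G e∉Y) (∉-∪ e∉G (∉-∪ e∉Y e∉Z))) ⟩
      oddIn S (G ∪ Y) ((G ∪ Y ∪ Z) ∪ ⁅ e ⁆)
        ≡⟨ cong (oddIn S (G ∪ Y))
             (solve 4 (λ g e y z → (g ⊕ y ⊕ z) ⊕ e ⊜ g ⊕ y ⊕ e ⊕ z) refl G ⁅ e ⁆ Y Z) ⟩
      oddIn S (G ∪ Y) (G ∪ Y ∪ ⁅ e ⁆ ∪ Z) ∎
    where
    e∉YZ : e ∉ Y × e ∉ Z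
    e∉YZ = canonical-∉ S X Y Z (subst (e ∈_) (proj₁ T≈) e∈)
    e∉Y : e ∉ Y
    e∉Y = proj₁ e∉YZ
    e∉Z : e ∉ Z
    e∉Z = proj₂ e∉YZ

  rawPenDel-canonical : rawDel (T +ₑ e) e ≈ canonical S (⁅ e ⁆ ∪ X) Y Z
  rawPenDel-canonical = ≈-trans (penrose-del T e) rawDel-canonical

rawDel-feasible⁻ : {e : Fin n} {F : Subset n} → Feasible (rawDel T e) F → Feasible T F × e ∉ F
rawDel-feasible⁻ {T = T} {e} {F} (F⊆ , fF) =
  isFeas⇒feasible {T = T} (∧-elimʳ {a = not (e ∈ᵇ F)} fF) , ∉-─ F⊆

rawCon-feasible⁻ : {e : Fin n} {G : Subset n} → Feasible (rawCon T e) G → Feasible T (G ∪ ⁅ e ⁆)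
rawCon-feasible⁻ {T = T} {e} {G} (_ , fG) = isFeas⇒feasible {T = T} (∧-elimʳ {a = not (e ∈ᵇ G)} fG)

─-mono : {F W : Subset n} (A : Subset n) → F ⊆ W → F ─ A ⊆ W ─ A
─-mono {F = F} A F⊆ x∈ = x∈p∧x∉q⇒x∈p─q (F⊆ (p─q⊆p F A x∈)) (x∈p─q⇒x∉q F A x∈)

rawDel-proper : {e : Fin n} {F : Subset n} → Feasible T F → e ∉ F → Proper (rawDel T e)
rawDel-proper {T = T} {e} {F} fF e∉F =
  F , subst (_⊆ ground T - e) (─-∉ F e∉F) (─-mono ⁅ e ⁆ (proj₁ fF)) ,
  cong₂ (λ a b → not a ∧ b) (∈ᵇ-no e∉F) (feasible⇒isFeas {T = T} fF)

rawCon-proper : {e : Fin n} {F : Subset n} → Feasible T F → e ∈ F → Proper (rawCon T e)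
rawCon-proper {T = T} {e} {F} fF e∈F =
  F - e , ─-mono ⁅ e ⁆ (proj₁ fF) ,
  cong₂ (λ a b → not a ∧ b) (∈ᵇ-no (∉-self F e))
    (trans (cong (isFeas T) (─∪-∈ F e∈F)) (feasible⇒isFeas {T = T} fF))

penrose-proper : (e : Fin n) → Proper T → Proper (T +ₑ e)
penrose-proper {T = T} e (F , fF) with e ∈? F | isFeas T (F - e) in fF-e
... | no e∉F  | _     = proper-intro {T = T +ₑ e} (trans (penrose-avoid T e e∉F) (feasible⇒isFeas {T = T} fF))
... | yes e∈F | true  = proper-intro {T = T +ₑ e} (trans (penrose-avoid T e (∉-self F e)) fF-e)
... | yes e∈F | false = F , proj₁ fF , (begin
  feas (T +ₑ e) F                                 ≡⟨ cong (feas (T +ₑ e)) (sym (─∪-∈ F e∈F)) ⟩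
  feas (T +ₑ e) ((F - e) ∪ ⁅ e ⁆)                 ≡⟨ penrose-add T e (∉-self F e) ⟩
  isFeas T (F - e) xor isFeas T ((F - e) ∪ ⁅ e ⁆) ≡⟨ cong₂ _xor_ fF-e (cong (isFeas T) (─∪-∈ F e∈F)) ⟩
  false xor isFeas T F                            ≡⟨ feasible⇒isFeas {T = T} fF ⟩
  true                                            ∎)
  where open ≡-Reasoning

penrose-back : (e : Fin n) → Proper (T +ₑ e) → Proper T
penrose-back {T = T} e (F , _ , fF) = oddIn-proper T fF

rawDel-back : (e : Fin n) → Proper (rawDel T e) → Proper T
rawDel-back {T = T} e (F , fF) = F , proj₁ (rawDel-feasible⁻ {T = T} fF)

rawCon-back : (e : Fin n) → Proper (rawCon T e) → Proper T
rawCon-back {T = T} e (G , fG) = G ∪ ⁅ e ⁆ , rawCon-feasible⁻ {T = T} fG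

loop-view : (T : SetSys n) (e : Fin n) →
  (isLoop T e ≡ true × (∀ F → Feasible T F → e ∉ F)) ⊎
  (isLoop T e ≡ false × ∃ λ F → Feasible T F × e ∈ F)
loop-view T e with count (λ F → isFeas T F ∧ (e ∈ᵇ F)) in c
... | zero  = inj₁ (refl , λ F fF e∈F →
  contradiction (trans (sym (cong₂ _∧_ (feasible⇒isFeas {T = T} fF) (∈ᵇ-yes e∈F))) (count-none _ c F)) λ ())
... | suc _ with count-some (λ F → isFeas T F ∧ (e ∈ᵇ F)) c
...   | F , hF = inj₂ (refl , F , isFeas⇒feasible {T = T} (∧-elimˡ hF) , ⌊⌋-sound (e ∈? F) (∧-elimʳ hF))

coloop-view : (T : SetSys n) (e : Fin n) →
  (isColoop T e ≡ true × (∀ F → Feasible T F → e ∈ F)) ⊎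
  (isColoop T e ≡ false × ∃ λ F → Feasible T F × e ∉ F)
coloop-view T e with count (λ F → isFeas T F ∧ not (e ∈ᵇ F)) in c
... | zero  = inj₁ (refl , contains-e)
  where
  contains-e : ∀ F → Feasible T F → e ∈ F
  contains-e F fF with e ∈? F
  ... | yes e∈F = e∈F
  ... | no  e∉F = contradiction
    (trans (sym (cong₂ (λ a b → a ∧ not b) (feasible⇒isFeas {T = T} fF) (∈ᵇ-no e∉F))) (count-none _ c F)) λ ()
... | suc _ with count-some (λ F → isFeas T F ∧ not (e ∈ᵇ F)) c
...   | F , hF = inj₂ (refl , F , isFeas⇒feasible {T = T} (∧-elimˡ hF) , λ e∈F →
  contradiction (trans (sym (cong not (∈ᵇ-yes e∈F))) (∧-elimʳ {a = isFeas T F} hF)) λ ())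

del-cases : (T : SetSys n) (e : Fin n) → del T e ≡ rawDel T e ⊎ del T e ≡ rawCon T e
del-cases T e with isColoop T e
... | true  = inj₂ refl
... | false = inj₁ refl

con-cases : (T : SetSys n) (e : Fin n) → con T e ≡ rawDel T e ⊎ con T e ≡ rawCon T e
con-cases T e with isLoop T e
... | true  = inj₁ refl
... | false = inj₂ refl

del-proper : (e : Fin n) → Proper T → Proper (del T e)
del-proper {T = T} e (F , fF) with coloop-view T e
... | inj₁ (c , all∋) rewrite c = rawCon-proper {T = T} fF (all∋ F fF)
... | inj₂ (c , G , fG , e∉G) rewrite c = rawDel-proper {T = T} fG e∉G

con-proper : (e : Fin n) → Proper T → Proper (con T e)
con-proper {T = T} e (F , fF) with loop-view T e
... | inj₁ (c , none∋) rewrite c = rawDel-proper {T = T} fF (none∋ F fF)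
... | inj₂ (c , G , fG , e∈G) rewrite c = rawCon-proper {T = T} fG e∈G

pen-proper : (e : Fin n) → Proper T → Proper (pen T e)
pen-proper e pT = con-proper e (penrose-proper e pT)

minor-proper : Proper S → Minor3 S T → Proper T
minor-proper pS done = pS
minor-proper pS (stepDel e _ m) = del-proper e (minor-proper pS m)
minor-proper pS (stepCon e _ m) = con-proper e (minor-proper pS m)
minor-proper pS (stepPen e _ m) = pen-proper e (minor-proper pS m)

-- If the raw operation yields a proper set system, e was not a coloop (for
-- deletion) or not a loop (for contraction), so the operation is the raw one.
del-nondegenerate : (T : SetSys n) (e : Fin n) → Proper (rawDel T e) → del T e ≡ rawDel T e
del-nondegenerate T e (F , fF) with coloop-view T e
... | inj₁ (_ , all∋) = let (fT , e∉F) = rawDel-feasible⁻ {T = T} fF in contradiction (all∋ F fT) e∉F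
... | inj₂ (c , _) rewrite c = refl

con-nondegenerate : (T : SetSys n) (e : Fin n) → Proper (rawCon T e) → con T e ≡ rawCon T e
con-nondegenerate T e (G , fG) with loop-view T e
... | inj₁ (_ , none∋) = contradiction (x∈p∪q⁺ (inj₂ (x∈⁅x⁆ e))) (none∋ _ (rawCon-feasible⁻ {T = T} fG))
... | inj₂ (c , _) rewrite c = refl

data Shifted (S : SetSys n) (X Y Z : Subset n) (e : Fin n) (T′ : SetSys n) : Set where
  into-X : T′ ≈ canonical S (⁅ e ⁆ ∪ X) Y Z → Shifted S X Y Z e T′
  into-Y : T′ ≈ canonical S X (⁅ e ⁆ ∪ Y) Z → Shifted S X Y Z e T′
  into-Z : T′ ≈ canonical S X Y (⁅ e ⁆ ∪ Z) → Shifted S X Y Z e T′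

module _ {S T : SetSys n} {X Y Z : Subset n} (T≈ : T ≈ canonical S X Y Z) {e : Fin n} (e∈ : e ∈ ground T) where

  del-shifted : Shifted S X Y Z e (del T e)
  del-shifted with del-cases T e
  ... | inj₁ eq = into-X (≈-trans (≈-reflexive eq) (rawDel-canonical T≈ e))
  ... | inj₂ eq = into-Y (≈-trans (≈-reflexive eq) (rawCon-canonical T≈ e e∈))

  con-shifted : Shifted S X Y Z e (con T e)
  con-shifted with con-cases T e
  ... | inj₁ eq = into-X (≈-trans (≈-reflexive eq) (rawDel-canonical T≈ e))
  ... | inj₂ eq = into-Y (≈-trans (≈-reflexive eq) (rawCon-canonical T≈ e e∈))

  pen-shifted : Shifted S X Y Z e (pen T e)
  pen-shifted with con-cases (T +ₑ e) e
  ... | inj₁ eq = into-X (≈-trans (≈-reflexive eq) (rawPenDel-canonical T≈ e))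
  ... | inj₂ eq = into-Z (≈-trans (≈-reflexive eq) (rawPen-canonical T≈ e e∈))

toSubset-++ : (A B : List (Fin n)) → toSubset (A ++ B) ≡ toSubset A ∪ toSubset B
toSubset-++ []      B = sym (∪-identityˡ (toSubset B))
toSubset-++ (a ∷ A) B =
  trans (cong (⁅ a ⁆ ∪_) (toSubset-++ A B)) (sym (∪-assoc ⁅ a ⁆ (toSubset A) (toSubset B)))

toSubset-++₃ : (xs ys zs : List (Fin n)) → toSubset (xs ++ ys ++ zs) ≡ toSubset xs ∪ toSubset ys ∪ toSubset zs
toSubset-++₃ xs ys zs = trans (toSubset-++ xs (ys ++ zs)) (cong (toSubset xs ∪_) (toSubset-++ ys zs))

toSubset-∷ʳ : (L : List (Fin n)) (e : Fin n) → toSubset (L ∷ʳ e) ≡ ⁅ e ⁆ ∪ toSubset L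
toSubset-∷ʳ L e = trans (toSubset-++ L (e ∷ []))
  (solve 2 (λ l e → l ⊕ (e ⊕ id) ⊜ e ⊕ l) refl (toSubset L) ⁅ e ⁆)
  where open ∪-Solver using (solve; _⊜_; _⊕_; id)

∈-toSubset⁺ : {x : Fin n} {L : List (Fin n)} → x ∈ₗ L → x ∈ toSubset L
∈-toSubset⁺ (hereₗ refl) = x∈p∪q⁺ (inj₁ (x∈⁅x⁆ _))
∈-toSubset⁺ (thereₗ x∈) = x∈p∪q⁺ (inj₂ (∈-toSubset⁺ x∈))

∈-toSubset⁻ : {x : Fin n} (L : List (Fin n)) → x ∈ toSubset L → x ∈ₗ L
∈-toSubset⁻ []      x∈ = contradiction x∈ ∉⊥
∈-toSubset⁻ (a ∷ L) x∈ with x∈p∪q⁻ ⁅ a ⁆ (toSubset L) x∈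
... | inj₁ x∈a = hereₗ (x∈⁅y⁆⇒x≡y a x∈a)
... | inj₂ x∈L = thereₗ (∈-toSubset⁻ L x∈L)

Unique-resp-↭ : {A : Set} {xs ys : List A} → xs ↭ ys → Unique xs → Unique ys
Unique-resp-↭ {A} p = PermutationSetoid.Unique-resp-↭ (setoid A) (↭⇒↭ₛ p)

Unique-++⁻ˡ : {A : Set} (xs : List A) {ys : List A} → Unique (xs ++ ys) → Unique xs
Unique-++⁻ˡ []       _          = []
Unique-++⁻ˡ (x ∷ xs) (x∉ ∷ u) = All-++⁻ˡ xs x∉ ∷ Unique-++⁻ˡ xs u

Clean : SetSys n → List (Fin n) → Set
Clean S L = All (_∈ ground S) L × Unique L

clean-insert : (A B : List (Fin n)) {e : Fin n} → e ∈ ground S → e ∉ toSubset (A ++ B) →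
  Clean S (A ++ B) → Clean S (A ++ e ∷ B)
clean-insert A B {e} e∈ e∉ (all , u) =
  All-resp-↭ (↭-sym (shift e A B)) (e∈ ∷ all) ,
  Unique-resp-↭ (↭-sym (shift e A B)) (¬Any⇒All¬ (A ++ B) (e∉ ∘ ∈-toSubset⁺) ∷ u)

clean-prefix : (A : List (Fin n)) {B : List (Fin n)} → Clean S (A ++ B) → Clean S A
clean-prefix A (all , u) = All-++⁻ˡ A all , Unique-++⁻ˡ A u

clean-snoc : (L : List (Fin n)) (e : Fin n) → Clean S (L ∷ʳ e) →
  Clean S L × e ∈ ground S × e ∉ toSubset L
clean-snoc {S = S} L e c@(all , u) =
  clean-prefix {S = S} L c ,
  head (All-++⁻ʳ L all) ,
  Unique[x∷xs]⇒x∉xs (Unique-resp-↭ (↭-sym (∷↭∷ʳ e L)) u) ∘ ∈-toSubset⁻ L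

applyAll-∷ʳ : (op : SetSys n → Fin n → SetSys n) (T : SetSys n) (L : List (Fin n)) (e : Fin n) →
  applyAll op T (L ∷ʳ e) ≡ op (applyAll op T L) e
applyAll-∷ʳ op T []      e = refl
applyAll-∷ʳ op T (x ∷ L) e = applyAll-∷ʳ op (op T x) L e

-- Every 3-minor has a canonical form.

record CanonicalForm (S T : SetSys n) : Set where
  constructor canonicalForm
  field
    xs ys zs : List (Fin n)
    clean    : Clean S (xs ++ ys ++ zs)
    equiv    : T ≈ canonical S (toSubset xs) (toSubset ys) (toSubset zs)

canonical-ground : (S : SetSys n) (xs ys zs : List (Fin n)) →
  ground S ─ toSubset (xs ++ ys ++ zs) ≡ ground (canonical S (toSubset xs) (toSubset ys) (toSubset zs))
canonical-ground S xs ys zs = cong (ground S ─_) (toSubset-++₃ xs ys zs)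

new-element : {S T : SetSys n} (cf : CanonicalForm S T) {e : Fin n} → e ∈ ground T →
  let open CanonicalForm cf in e ∈ ground S × e ∉ toSubset (xs ++ ys ++ zs)
new-element {S = S} (canonicalForm xs ys zs _ T≈) e∈T =
  p─q⊆p (ground S) _ e∈W , x∈p─q⇒x∉q (ground S) _ e∈W
  where
  e∈W : _ ∈ ground S ─ toSubset (xs ++ ys ++ zs)
  e∈W = subst (_ ∈_) (trans (proj₁ T≈) (sym (canonical-ground S xs ys zs))) e∈T

extend : {S T T′ : SetSys n} (cf : CanonicalForm S T) {e : Fin n} → e ∈ ground T →
  let open CanonicalForm cf in
  Shifted S (toSubset xs) (toSubset ys) (toSubset zs) e T′ → CanonicalForm S T′
extend {S = S} cf@(canonicalForm xs ys zs c _) {e} e∈T (into-X T′≈) =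
  let (e∈S , e∉) = new-element cf e∈T in
  canonicalForm (e ∷ xs) ys zs (clean-insert {S = S} [] _ e∈S e∉ c) T′≈
extend {S = S} cf@(canonicalForm xs ys zs c _) {e} e∈T (into-Y T′≈) =
  let (e∈S , e∉) = new-element cf e∈T in
  canonicalForm xs (e ∷ ys) zs (clean-insert {S = S} xs (ys ++ zs) e∈S e∉ c) T′≈
extend {S = S} cf@(canonicalForm xs ys zs c _) {e} e∈T (into-Z T′≈) =
  let (e∈S , e∉) = new-element cf e∈T in
  canonicalForm xs ys (e ∷ zs)
    (subst (Clean S) reassoc (clean-insert {S = S} (xs ++ ys) zs e∈S
      (subst (λ L → e ∉ toSubset L) (sym reassoc) e∉) (subst (Clean S) (sym reassoc) c)))
    T′≈
  where
  reassoc : ∀ {B} → (xs ++ ys) ++ B ≡ xs ++ ys ++ B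
  reassoc {B} = ++-assoc xs ys B

canonical-form : {S T : SetSys n} → Minor3 S T → CanonicalForm S T
canonical-form {S = S} done = canonicalForm [] [] [] ([] , []) (canonical-empty S)
canonical-form (stepDel e e∈ m) with canonical-form m
... | cf = extend cf e∈ (del-shifted (CanonicalForm.equiv cf) e∈)
canonical-form (stepCon e e∈ m) with canonical-form m
... | cf = extend cf e∈ (con-shifted (CanonicalForm.equiv cf) e∈)
canonical-form (stepPen e e∈ m) with canonical-form m
... | cf = extend cf e∈ (pen-shifted (CanonicalForm.equiv cf) e∈)

-- The canonical sequence of operations reaches the canonical minor.

-- R A is the canonical minor reached once the elements of A are
-- processed, pre lists the elements processed in earlier phases, and raw is
-- the operation that op performs whenever its result is proper.
module Phase {n : ℕ} (S : SetSys n) (op raw : SetSys n → Fin n → SetSys n)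
  (nondegenerate : ∀ T e → Proper (raw T e) → op T e ≡ raw T e)
  (raw-back : ∀ T e → Proper (raw T e) → Proper T)
  (pre : List (Fin n)) (R : Subset n → SetSys n)
  (R-ground : ∀ A → ground (R A) ≡ ground S ─ (toSubset pre ∪ A))
  (raw-R : ∀ T A e → e ∈ ground (R A) → T ≈ R A → raw T e ≈ R (⁅ e ⁆ ∪ A))
  where

  private
    last-available : ∀ L e → Clean S (pre ++ L ∷ʳ e) → Clean S (pre ++ L) × e ∈ ground (R (toSubset L))
    last-available L e c with clean-snoc {S = S} (pre ++ L) e (subst (Clean S) (sym (++-assoc pre L (e ∷ []))) c)
    ... | c′ , e∈S , e∉ = c′ , subst (e ∈_) (sym (R-ground (toSubset L)))
                                 (x∈p∧x∉q⇒x∈p─q e∈S (e∉ ∘ subst (e ∈_) (sym (toSubset-++ pre L))))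

    back-step : ∀ A e → e ∈ ground (R A) → Proper (R (⁅ e ⁆ ∪ A)) → Proper (R A)
    back-step A e e∈ p = raw-back (R A) e (proper-≈ (≈-sym (raw-R (R A) A e e∈ ≈-refl)) p)

    proper-∷ʳ : ∀ L e → Proper (R (toSubset (L ∷ʳ e))) → Proper (R (⁅ e ⁆ ∪ toSubset L))
    proper-∷ʳ L e = subst (Proper ∘ R) (toSubset-∷ʳ L e)

  start-proper : ∀ L → Clean S (pre ++ L) → Proper (R (toSubset L)) → Proper (R ⊥)
  start-proper L = go (reverseView L)
    where
    go : ∀ {L} → Reverse L → Clean S (pre ++ L) → Proper (R (toSubset L)) → Proper (R ⊥)
    go []            _ p = p
    go (L ∶ r ∶ʳ e) c p =
      let (c′ , e∈) = last-available L e c in go r c′ (back-step _ e e∈ (proper-∷ʳ L e p))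

  run : ∀ {T} L → T ≈ R ⊥ → Clean S (pre ++ L) → Proper (R (toSubset L)) → applyAll op T L ≈ R (toSubset L)
  run {T} L T≈ = go (reverseView L)
    where
    go : ∀ {L} → Reverse L → Clean S (pre ++ L) → Proper (R (toSubset L)) → applyAll op T L ≈ R (toSubset L)
    go []            _ _ = T≈
    go (L ∶ r ∶ʳ e) c p with last-available L e c
    ... | c′ , e∈ = ≈-trans (≈-reflexive (trans (applyAll-∷ʳ op T L e) (nondegenerate _ e proper-raw)))
                            (≈-trans raw≈ (≈-reflexive (cong R (sym (toSubset-∷ʳ L e)))))
      where
      p′ : Proper (R (⁅ e ⁆ ∪ toSubset L))
      p′ = proper-∷ʳ L e p
      raw≈ : raw (applyAll op T L) e ≈ R (⁅ e ⁆ ∪ toSubset L)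
      raw≈ = raw-R _ _ e e∈ (go r c′ (back-step _ e e∈ p′))
      proper-raw : Proper (raw (applyAll op T L) e)
      proper-raw = proper-≈ (≈-sym raw≈) p′

module CanonicalSequence {n : ℕ} (S : SetSys n) (xs ys zs : List (Fin n)) where
  open ∪-Solver {n} using (solve; _⊜_; _⊕_; id)

  private
    X Y Z : Subset n
    X = toSubset xs
    Y = toSubset ys
    Z = toSubset zs

    available : {T A : SetSys n} {e : Fin n} → T ≈ A → e ∈ ground A → e ∈ ground T
    available T≈A = subst (_ ∈_) (sym (proj₁ T≈A))

  module Deletions = Phase S del rawDel del-nondegenerate (λ T → rawDel-back {T = T})
    [] (λ A → canonical S A ⊥ ⊥)
    (λ A → cong (ground S ─_) (solve 1 (λ a → a ⊕ id ⊕ id ⊜ id ⊕ a) refl A))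
    (λ T A e _ T≈ → rawDel-canonical T≈ e)

  module Contractions = Phase S con rawCon con-nondegenerate (λ T → rawCon-back {T = T})
    xs (λ A → canonical S X A ⊥)
    (λ A → cong (ground S ─_) (solve 2 (λ x a → x ⊕ a ⊕ id ⊜ x ⊕ a) refl X A))
    (λ T A e e∈ T≈ → rawCon-canonical T≈ e (available T≈ e∈))

  module PenroseContractions = Phase S pen (λ T e → rawCon (T +ₑ e) e)
    (λ T e → con-nondegenerate (T +ₑ e) e) (λ T e p → penrose-back {T = T} e (rawCon-back e p))
    (xs ++ ys) (λ A → canonical S X Y A)
    (λ A → cong (ground S ─_) (trans (solve 3 (λ x y a → x ⊕ y ⊕ a ⊜ (x ⊕ y) ⊕ a) refl X Y A)
                                      (cong (_∪ A) (sym (toSubset-++ xs ys)))))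
    (λ T A e e∈ T≈ → rawPen-canonical T≈ e (available T≈ e∈))

  reaches : Clean S (xs ++ ys ++ zs) → Proper (canonical S X Y Z) →
    applyAll pen (applyAll con (applyAll del S xs) ys) zs ≈ canonical S X Y Z
  reaches c p =
    PenroseContractions.run zs (Contractions.run ys (Deletions.run xs (canonical-empty S) c₁ p₁) c₂ p₂) c₃ p
    where
    c₃ : Clean S ((xs ++ ys) ++ zs)
    c₃ = subst (Clean S) (sym (++-assoc xs ys zs)) c
    c₂ : Clean S (xs ++ ys)
    c₂ = clean-prefix {S = S} (xs ++ ys) c₃
    c₁ : Clean S xs
    c₁ = clean-prefix {S = S} xs c₂
    p₂ : Proper (canonical S X Y ⊥)
    p₂ = PenroseContractions.start-proper zs c₃ p
    p₁ : Proper (canonical S X ⊥ ⊥)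
    p₁ = Contractions.start-proper ys c₂ p₂

lemma3p3 : {n : ℕ} (S S' : SetSys n) → Proper S → Minor3 S S' →
    Σ (List (Fin n)) λ xs → Σ (List (Fin n)) λ ys → Σ (List (Fin n)) λ zs →
      All (λ e → e Data.Fin.Subset.∈ ground S) (xs ++ ys ++ zs) ×
      Unique (xs ++ ys ++ zs) ×
      S' ≈ applyAll pen (applyAll con (applyAll del S xs) ys) zs ×
      ∃ λ (F : Subset n) →
        F ⊆ (ground S ─ toSubset (xs ++ ys ++ zs)) ×
        isOdd (count (λ F' → isFeas S F' ∧
          (⌊ (F ∪ toSubset ys) ⊆? F' ⌋ ∧ ⌊ F' ⊆? (F ∪ toSubset ys ∪ toSubset zs) ⌋)))
          ≡ true
lemma3p3 S S' pS m with canonical-form m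
... | canonicalForm xs ys zs clean S'≈ with proper-≈ S'≈ (minor-proper pS m)
...   | F , F⊆ , fF =
  xs , ys , zs , proj₁ clean , proj₂ clean ,
  ≈-trans S'≈ (≈-sym (CanonicalSequence.reaches S xs ys zs clean (F , F⊆ , fF))) ,
  F , subst (F ⊆_) (sym (canonical-ground S xs ys zs)) F⊆ , fF
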